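{- Let $p$ be a prime and $d$ an integer with $1<d<p$ and $\phi(d)\le2$, and put $N=\lfloor\frac{p-1}{d}\rfloor$. Then for integers $0\le j\le p-1$, \[ \Gamma_p\!\left(\tfrac1d+j\right)\Gamma_p\!\left(\tfrac{d-1}{d}+j\right)=\Gamma_p\!\left(\tfrac1d\right)\Gamma_p\!\left(\tfrac{d-1}{d}\right)\left(\tfrac1d\right)_j\left(\tfrac{d-1}{d}\right)_j\cdot\begin{cases}1 & 0\le j\le N,\\ \frac dp & N+1\le j\le p-N-1,\\ \frac{d^2}{(d-1)p^2} & p-N\le j\le p-1.\end{cases} \]
   Context: $\Gamma_p$ is Morita's $p$-adic gamma function: $\Gamma_p(n)=(-1)^n\prod_{j<n,\,p\nmid j}j$ for $n\in\mathbb{N}$, extended continuously to $\mathbb{Z}_p$ with $\Gamma_p(0)=1$. $(a)_0=1$, $(a)_j=a(a+1)\cdots(a+j-1)$. -}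

module Defs where

open import Data.Nat as ℕ using (ℕ; zero; suc; _≤_; _<_; _∸_)
open import Data.Nat.GCD using (gcd)
open import Data.Nat.Divisibility using (_∣?_)
open import Data.List using (List; length; filter; upTo; map)
open import Data.Integer as ℤ using (ℤ; +_; -_; _-_; _*_)
open import Data.Integer.Divisibility as ℤD using ()
open import Relation.Nullary using (does)
open import Data.Bool using (if_then_else_)
open import Data.Nat using (_≟_)

totient : ℕ → ℕ
totient d = length (filter (λ m → gcd (suc m) d ≟ 1) (upTo d))

unitProd : ℕ → ℕ → ℤ
unitProd p zero = + 1
unitProd p (suc n) = unitProd p n * (if does (p ∣? n) then + 1 else + n)

-- Morita's p-adic gamma function on natural numbers:
-- Γ_p(n) = (-1)^n ∏_{j<n, p∤j} j
Γₚℕ : ℕ → ℕ → ℤ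
Γₚℕ p n = (- + 1) ℤ.^ n * unitProd p n

poch : ℤ → ℕ → ℤ
poch a zero = + 1
poch a (suc j) = poch a j * (a ℤ.+ + j)

infix 4 _≡_[mod_]
_≡_[mod_] : ℤ → ℤ → ℕ → Set
x ≡ y [mod m ] = (+ m) ℤD.∣ (x - y)

{-# OPTIONS --safe #-}
-- Γₚ(x + j) differs from ±Γₚ(x)(x)_j exactly by the factors x + i (i < j) divisible by p.
-- Write p = r + qd with 0 ≤ r < d; φ(d) ≤ 2 forces r ∈ {1, d − 1}, as otherwise 1, r and d − 1
-- would be three units modulo d. Let {x, y} = {a, b} with dx ≡ r and dy ≡ d − r modulo p^k.
-- Among the indices i < p, the only factor x + i divisible by p is x + q, and d(x + q) ≡ p; the
-- only such y + i is y + (p − q − 1), and d(y + p − q − 1) ≡ (d − 1)p. The three ranges of j are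
-- the three ways these two factors can have appeared among the first j.
module Submission where

open import Defs

module Arithmetic where

  open import Function using (_∘′_)
  open import Data.Nat
  open import Data.Nat.Properties
  open import Data.Nat.GCD using (gcd; gcd-zeroˡ)
  open import Data.Nat.Coprimality using (Coprime; coprime⇒gcd≡1; 0-coprimeTo-m⇒m≡1; prime⇒coprime)
  open import Data.Nat.Divisibility using (_∣_; divides; ∣1⇒≡1; ∣m∣n⇒∣m+n; ∣m+n∣m⇒∣n; ∣n⇒∣m*n)
  open import Data.Nat.DivMod using (m≡m%n+[m/n]*n; m%n<n; m*n/n≡m; m<n⇒m/n≡0; +-distrib-/-∣ʳ)
  open import Data.Nat.Primality using (Prime)
  open import Data.Nat.Tactic.RingSolver using (solve-∀)
  open import Data.List using ([]; _∷_; _∷ʳ_; _++_; length; filter; upTo)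
  open import Data.List.Properties using (length-++; filter-++; filter-accept; upTo-∷ʳ)
  open import Data.Product using (_×_; _,_)
  open import Data.Sum using (_⊎_; inj₁; inj₂)
  open import Relation.Nullary using (yes; no; contradiction)
  open import Relation.Unary using (Pred; Decidable)
  open import Relation.Binary.PropositionalEquality

  module _ {ℓ} {P : Pred ℕ ℓ} (P? : Decidable P) where

    countBelow : ℕ → ℕ
    countBelow n = length (filter P? (upTo n))

    countBelow-suc : ∀ n → countBelow (suc n) ≡ countBelow n + length (filter P? (n ∷ []))
    countBelow-suc n = begin
      length (filter P? (upTo (suc n)))                 ≡⟨ cong (length ∘′ filter P?) (upTo-∷ʳ n) ⟨
      length (filter P? (upTo n ∷ʳ n))                  ≡⟨ cong length (filter-++ P? (upTo n) (n ∷ [])) ⟩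
      length (filter P? (upTo n) ++ filter P? (n ∷ [])) ≡⟨ length-++ (filter P? (upTo n)) ⟩
      countBelow n + length (filter P? (n ∷ []))        ∎
      where open ≡-Reasoning

    countBelow-mono : ∀ {m n} → m ≤ n → countBelow m ≤ countBelow n
    countBelow-mono {n = zero}  z≤n = ≤-refl
    countBelow-mono {m} {suc n} m≤1+n with m≤n⇒m<n∨m≡n m≤1+n
    ... | inj₂ refl       = ≤-refl
    ... | inj₁ (s≤s m≤n) = ≤-trans (countBelow-mono m≤n)
                             (≤-trans (m≤m+n _ _) (≤-reflexive (sym (countBelow-suc n))))

    countBelow-hit : ∀ {m n} → P m → m < n → suc (countBelow m) ≤ countBelow n
    countBelow-hit {m} Pm m<n = ≤-trans (≤-reflexive hit) (countBelow-mono m<n)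
      where
      hit : suc (countBelow m) ≡ countBelow (suc m)
      hit = begin
        suc (countBelow m)                         ≡⟨ +-comm 1 _ ⟩
        countBelow m + 1                           ≡⟨ cong (λ xs → countBelow m + length xs) (filter-accept P? Pm) ⟨
        countBelow m + length (filter P? (m ∷ [])) ≡⟨ countBelow-suc m ⟨
        countBelow (suc m)                         ∎
        where open ≡-Reasoning

  coprime-suc : ∀ n → Coprime n (suc n)
  coprime-suc n (i∣n , i∣1+n) = ∣1⇒≡1 (∣m+n∣m⇒∣n (subst (_∣_ _) (+-comm 1 n) i∣1+n) i∣n)

  coprime-% : ∀ {m n} .{{_ : NonZero n}} → Coprime m n → Coprime (m % n) n
  coprime-% {m} {n} coprime (i∣m%n , i∣n) = coprime (subst (_ ∣_) (sym (m≡m%n+[m/n]*n m n)) i∣m , i∣n)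
    where i∣m = ∣m∣n⇒∣m+n i∣m%n (∣n⇒∣m*n (m / n) i∣n)

  -- totient d counts the m < d with gcd (m + 1) d ≡ 1; the three counted here are 0, r − 1 and d − 2.
  3≤totient : ∀ {d r} → 1 < r → suc r < d → gcd r d ≡ 1 → 3 ≤ totient d
  3≤totient {suc (suc d)} {suc (suc r)} (s≤s (s≤s _)) (s≤s (s≤s 1+r<d)) coprime =
    ≤-trans (s≤s (≤-trans (s≤s one≤) (countBelow-hit P? coprime 1+r<d)))
            (countBelow-hit P? (coprime⇒gcd≡1 (coprime-suc (suc d))) (m<n⇒m<1+n (n<1+n d)))
    where
    P? = λ m → gcd (suc m) (suc (suc d)) ≟ 1
    one≤ : 1 ≤ countBelow P? (suc r)
    one≤ = countBelow-hit P? (gcd-zeroˡ (suc (suc d))) (s≤s z≤n)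

  prime-%-≡1⊎≡pred : ∀ {p d} .{{_ : NonZero d}} → Prime p → 1 < d → d < p → totient d ≤ 2 →
                     p % d ≡ 1 ⊎ p % d ≡ d ∸ 1
  prime-%-≡1⊎≡pred {p} {d} p-prime 1<d d<p totient≤2 = classify (p % d) refl
    where
    coprime : Coprime (p % d) d
    coprime = coprime-% (prime⇒coprime p-prime d<p)
    classify : ∀ r → p % d ≡ r → r ≡ 1 ⊎ r ≡ d ∸ 1
    classify zero            eq =
      contradiction (0-coprimeTo-m⇒m≡1 (subst (λ r → Coprime r d) eq coprime)) (>⇒≢ 1<d)
    classify (suc zero)      eq = inj₁ refl
    classify r@(suc (suc _)) eq with r ≟ d ∸ 1
    ... | yes r≡d-1 = inj₂ r≡d-1
    ... | no  r≢d-1 = contradiction (3≤totient (s≤s (s≤s z≤n)) 1+r<d gcd≡1) (<⇒≱ (s≤s totient≤2))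
      where
      r<d : r < d
      r<d = subst (_< d) eq (m%n<n p d)
      1+r<d : suc r < d
      1+r<d = ≤∧≢⇒< r<d (λ 1+r≡d → r≢d-1 (cong (_∸ 1) 1+r≡d))
      gcd≡1 : gcd r d ≡ 1
      gcd≡1 = coprime⇒gcd≡1 (subst (λ r → Coprime r d) eq coprime)

  division-facts : ∀ {p d r s} q .{{_ : NonZero d}} → 0 < r → 1 < d → r + s ≡ d → p ≡ r + q * d →
                   (p ∸ 1) / d ≡ q × q < p × q ≤ p ∸ q ∸ 1 × r + d * q ≡ p × s + d * (p ∸ q ∸ 1) ≡ (d ∸ 1) * p
  division-facts {r = suc r} {s} q (s≤s z≤n) (s≤s 1≤r+s) refl refl =
    quotient , q<p , q≤T , cong (suc r +_) (*-comm d q) , cofactor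
    where
    d = suc r + s
    p = suc r + q * d
    T≡ : p ∸ q ∸ 1 ≡ r + q * (r + s)
    T≡ = begin
      p ∸ q ∸ 1                         ≡⟨ cong (λ n → n ∸ q ∸ 1) (split r s q) ⟩
      q + suc (r + q * (r + s)) ∸ q ∸ 1 ≡⟨ cong (_∸ 1) (m+n∸m≡n q _) ⟩
      r + q * (r + s)                   ∎
      where
      open ≡-Reasoning
      split : ∀ r s q → suc r + q * (suc r + s) ≡ q + suc (r + q * (r + s))
      split = solve-∀
    quotient : (p ∸ 1) / d ≡ q
    quotient = begin
      (r + q * d) / d      ≡⟨ +-distrib-/-∣ʳ r (divides q refl) ⟩
      r / d + q * d / d    ≡⟨ cong₂ _+_ (m<n⇒m/n≡0 (s≤s (m≤m+n r s))) (m*n/n≡m q d) ⟩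
      q                    ∎
      where open ≡-Reasoning
    q<p : q < p
    q<p = s≤s (≤-trans (m≤m*n q d) (m≤n+m _ r))
    q≤T : q ≤ p ∸ q ∸ 1
    q≤T = subst (q ≤_) (sym T≡) (≤-trans (m≤m*n q (r + s) {{>-nonZero 1≤r+s}}) (m≤n+m _ r))
    cofactor : s + d * (p ∸ q ∸ 1) ≡ (d ∸ 1) * p
    cofactor = trans (cong (λ T → s + d * T) T≡) (expand r s q)
      where
      expand : ∀ r s q → s + (suc r + s) * (r + q * (r + s)) ≡ (r + s) * (suc r + q * (suc r + s))
      expand = solve-∀

open Arithmetic using (prime-%-≡1⊎≡pred; division-facts)

open import Data.Bool using (if_then_else_; true; false)
import Data.Nat
open import Data.Nat as ℕ using (ℕ; zero; suc; _≤_; _<_; _∸_; _/_; _%_; _^_; NonZero; z≤n; s≤s)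
import Data.Nat.Properties as ℕP
open import Data.Nat.Divisibility using (_∣_; _∤_; _∣?_; ∣-trans; ∣-refl; _∣0; 1∣_; m∣m*n; n∣m*n; ∣m+n∣m⇒∣n; >⇒∤)
open import Data.Nat.DivMod using (m≡m%n+[m/n]*n)
open import Data.Nat.Primality using (Prime; euclidsLemma)
open import Data.Integer as ℤ using (ℤ; +_; -_; _*_; _+_; _-_)
import Data.Integer.Divisibility as ℤD
import Data.Integer.Divisibility.Signed as ℤS
import Data.Integer.Properties as ℤP
open import Data.Integer.Tactic.RingSolver using (solve-∀)
open import Data.Product using (_×_; _,_)
open import Data.Sum using (inj₁; inj₂; [_,_]′)
open import Level using (0ℓ)
open import Relation.Nullary using (does; contradiction)
open import Relation.Nullary.Decidable using (dec-true; dec-false)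
open import Relation.Binary.Bundles using (Setoid)
open import Relation.Binary.PropositionalEquality
import Relation.Binary.Reasoning.Setoid

unitFactor : ℕ → ℕ → ℤ
unitFactor p n = if does (p ∣? n) then + 1 else + n

multipleFactor : ℕ → ℕ → ℤ
multipleFactor p n = if does (p ∣? n) then + n else + 1

multiplesProd : ℕ → ℕ → ℕ → ℤ
multiplesProd p x zero    = + 1
multiplesProd p x (suc j) = multiplesProd p x j * multipleFactor p (x ℕ.+ j)

unitFactor*multipleFactor : ∀ p n → unitFactor p n * multipleFactor p n ≡ + n
unitFactor*multipleFactor p n with does (p ∣? n)
... | true  = ℤP.*-identityˡ (+ n)
... | false = ℤP.*-identityʳ (+ n)

Γₚℕ-suc : ∀ p n → Γₚℕ p (suc n) ≡ - + 1 * (Γₚℕ p n * unitFactor p n)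
Γₚℕ-suc p n = reassoc ((- + 1) ℤ.^ n) (unitProd p n) (unitFactor p n)
  where
  reassoc : ∀ s U u → (- + 1 * s) * (U * u) ≡ - + 1 * (s * U * u)
  reassoc = solve-∀

Γₚℕ-+-shift : ∀ p x j → Γₚℕ p (x ℕ.+ j) * multiplesProd p x j ≡ (- + 1) ℤ.^ j * (Γₚℕ p x * poch (+ x) j)
Γₚℕ-+-shift p x zero = begin
  Γₚℕ p (x ℕ.+ 0) * + 1     ≡⟨ ℤP.*-identityʳ _ ⟩
  Γₚℕ p (x ℕ.+ 0)           ≡⟨ cong (Γₚℕ p) (ℕP.+-identityʳ x) ⟩
  Γₚℕ p x                   ≡⟨ ℤP.*-identityʳ _ ⟨
  Γₚℕ p x * + 1             ≡⟨ ℤP.*-identityˡ _ ⟨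
  + 1 * (Γₚℕ p x * + 1)     ∎
  where open ≡-Reasoning
Γₚℕ-+-shift p x (suc j) = begin
  Γₚℕ p (x ℕ.+ suc j) * (E * f)       ≡⟨ cong (λ n → Γₚℕ p n * (E * f)) (ℕP.+-suc x j) ⟩
  Γₚℕ p (suc (x ℕ.+ j)) * (E * f)     ≡⟨ cong (_* (E * f)) (Γₚℕ-suc p (x ℕ.+ j)) ⟩
  - + 1 * (Γ * u) * (E * f)           ≡⟨ regroup Γ u E f ⟩
  - + 1 * (Γ * E) * (u * f)           ≡⟨ cong₂ (λ g n → - + 1 * g * n) (Γₚℕ-+-shift p x j)
                                                                    (unitFactor*multipleFactor p (x ℕ.+ j)) ⟩
  - + 1 * (S * (G * P)) * + (x ℕ.+ j) ≡⟨ cong (λ n → - + 1 * (S * (G * P)) * n) (ℤP.pos-+ x j) ⟩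
  - + 1 * (S * (G * P)) * (+ x + + j) ≡⟨ regroup′ S G P (+ x + + j) ⟩
  - + 1 * S * (G * (P * (+ x + + j))) ∎
  where
  open ≡-Reasoning
  Γ = Γₚℕ p (x ℕ.+ j)
  E = multiplesProd p x j
  u = unitFactor p (x ℕ.+ j)
  f = multipleFactor p (x ℕ.+ j)
  S = (- + 1) ℤ.^ j
  G = Γₚℕ p x
  P = poch (+ x) j
  regroup : ∀ Γ u E f → - + 1 * (Γ * u) * (E * f) ≡ - + 1 * (Γ * E) * (u * f)
  regroup = solve-∀
  regroup′ : ∀ S G P n → - + 1 * (S * (G * P)) * n ≡ - + 1 * S * (G * (P * n))
  regroup′ = solve-∀

[-1]^n*[-1]^n≡1 : ∀ n → (- + 1) ℤ.^ n * (- + 1) ℤ.^ n ≡ + 1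
[-1]^n*[-1]^n≡1 zero    = refl
[-1]^n*[-1]^n≡1 (suc n) = trans (square-neg ((- + 1) ℤ.^ n)) ([-1]^n*[-1]^n≡1 n)
  where
  square-neg : ∀ s → (- + 1 * s) * (- + 1 * s) ≡ s * s
  square-neg = solve-∀

Γₚℕ-pair-shift : ∀ p a b j → Γₚℕ p (a ℕ.+ j) * Γₚℕ p (b ℕ.+ j) * (multiplesProd p a j * multiplesProd p b j)
                           ≡ Γₚℕ p a * Γₚℕ p b * poch (+ a) j * poch (+ b) j
Γₚℕ-pair-shift p a b j = begin
  Γₚℕ p (a ℕ.+ j) * Γₚℕ p (b ℕ.+ j) * (multiplesProd p a j * multiplesProd p b j)
    ≡⟨ interchange (Γₚℕ p (a ℕ.+ j)) (Γₚℕ p (b ℕ.+ j)) (multiplesProd p a j) (multiplesProd p b j) ⟩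
  (Γₚℕ p (a ℕ.+ j) * multiplesProd p a j) * (Γₚℕ p (b ℕ.+ j) * multiplesProd p b j)
    ≡⟨ cong₂ _*_ (Γₚℕ-+-shift p a j) (Γₚℕ-+-shift p b j) ⟩
  (S * (Γₚℕ p a * poch (+ a) j)) * (S * (Γₚℕ p b * poch (+ b) j))
    ≡⟨ regroup S (Γₚℕ p a) (poch (+ a) j) (Γₚℕ p b) (poch (+ b) j) ⟩
  (S * S) * R
    ≡⟨ cong (_* R) ([-1]^n*[-1]^n≡1 j) ⟩
  + 1 * R
    ≡⟨ ℤP.*-identityˡ R ⟩
  R ∎
  where
  open ≡-Reasoning
  S = (- + 1) ℤ.^ j
  R = Γₚℕ p a * Γₚℕ p b * poch (+ a) j * poch (+ b) j
  interchange : ∀ A B e f → A * B * (e * f) ≡ (A * e) * (B * f)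
  interchange = solve-∀
  regroup : ∀ S A P B Q → (S * (A * P)) * (S * (B * Q)) ≡ (S * S) * (A * B * P * Q)
  regroup = solve-∀

multipleFactor-∣ : ∀ {p n} → p ∣ n → multipleFactor p n ≡ + n
multipleFactor-∣ {p} {n} p∣n rewrite dec-true (p ∣? n) p∣n = refl

multipleFactor-∤ : ∀ {p n} → p ∤ n → multipleFactor p n ≡ + 1
multipleFactor-∤ {p} {n} p∤n rewrite dec-false (p ∣? n) p∤n = refl

∣∧<⇒≡0 : ∀ {p n} → p ∣ n → n < p → n ≡ 0
∣∧<⇒≡0 {n = zero}  _   _   = refl
∣∧<⇒≡0 {n = suc _} p∣n n<p = contradiction p∣n (>⇒∤ n<p)

∣-+-offset-unique : ∀ {p x i t} → p ∣ x ℕ.+ i → p ∣ x ℕ.+ t → i < p → t < p → i ≡ t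
∣-+-offset-unique {p} {x} {i} {t} p∣x+i p∣x+t i<p t<p =
  [ unique-≤ p∣x+i p∣x+t t<p , (λ t≤i → sym (unique-≤ p∣x+t p∣x+i i<p t≤i)) ]′ (ℕP.≤-total i t)
  where
  unique-≤ : ∀ {i t} → p ∣ x ℕ.+ i → p ∣ x ℕ.+ t → t < p → i ≤ t → i ≡ t
  unique-≤ {i} {t} p∣x+i p∣x+t t<p i≤t =
    ℕP.≤-antisym i≤t (ℕP.m∸n≡0⇒m≤n (∣∧<⇒≡0 p∣t∸i (ℕP.≤-<-trans (ℕP.m∸n≤m t i) t<p)))
    where
    x+t≡x+i+[t∸i] : x ℕ.+ t ≡ x ℕ.+ i ℕ.+ (t ∸ i)
    x+t≡x+i+[t∸i] = trans (cong (x ℕ.+_) (sym (ℕP.m+[n∸m]≡n i≤t))) (sym (ℕP.+-assoc x i (t ∸ i)))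
    p∣t∸i : p ∣ t ∸ i
    p∣t∸i = ∣m+n∣m⇒∣n (subst (p ∣_) x+t≡x+i+[t∸i] p∣x+t) p∣x+i

multiplesProd-before : ∀ {p x t} j → t < p → p ∣ x ℕ.+ t → j ≤ t → multiplesProd p x j ≡ + 1
multiplesProd-before zero    _   _     _   = refl
multiplesProd-before {p} {x} (suc j) t<p p∣x+t j<t =
  cong₂ _*_ (multiplesProd-before j t<p p∣x+t (ℕP.<⇒≤ j<t)) (multipleFactor-∤ p∤x+j)
  where
  p∤x+j : p ∤ x ℕ.+ j
  p∤x+j p∣x+j = ℕP.<⇒≢ j<t (∣-+-offset-unique p∣x+j p∣x+t (ℕP.<-trans j<t t<p) t<p)

multiplesProd-after : ∀ {p x t} j → t < j → j ≤ p → p ∣ x ℕ.+ t → multiplesProd p x j ≡ + (x ℕ.+ t)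
multiplesProd-after {p} {x} {t} (suc j) (s≤s t≤j) j<p p∣x+t with ℕP.m≤n⇒m<n∨m≡n t≤j
... | inj₂ refl = trans (cong₂ _*_ (multiplesProd-before t j<p p∣x+t ℕP.≤-refl) (multipleFactor-∣ p∣x+t))
                        (ℤP.*-identityˡ _)
... | inj₁ t<j  = trans (cong₂ _*_ (multiplesProd-after j t<j (ℕP.<⇒≤ j<p) p∣x+t) (multipleFactor-∤ p∤x+j))
                        (ℤP.*-identityʳ _)
  where
  p∤x+j : p ∤ x ℕ.+ j
  p∤x+j p∣x+j = ℕP.<⇒≢ t<j (∣-+-offset-unique p∣x+t p∣x+j (ℕP.<-trans t<j j<p) j<p)

-- _≡_[mod_] unfolds to divisibility of an absolute value, from which unification cannot
-- recover the two sides; this wrapper keeps them visible.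
infix 4 _≈_[mod_]
record _≈_[mod_] (x y : ℤ) (m : ℕ) : Set where
  constructor wrap
  field unwrap : x ≡ y [mod m ]

open _≈_[mod_] using (unwrap)

module _ {m : ℕ} where

  private
    toSigned : ∀ {x y} → x ≈ y [mod m ] → + m ℤS.∣ (x - y)
    toSigned {x} {y} (wrap x≡y) = ℤS.∣ᵤ⇒∣ {+ m} {x - y} x≡y

    fromSigned : ∀ {x y} → + m ℤS.∣ (x - y) → x ≈ y [mod m ]
    fromSigned m∣x-y = wrap (ℤS.∣⇒∣ᵤ m∣x-y)

  ≈-mod-reflexive : ∀ {x y} → x ≡ y → x ≈ y [mod m ]
  ≈-mod-reflexive {x} refl = wrap (subst (m ∣_) (cong ℤ.∣_∣ (sym (ℤP.+-inverseʳ x))) (m ∣0))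

  ≈-mod-sym : ∀ {x y} → x ≈ y [mod m ] → y ≈ x [mod m ]
  ≈-mod-sym {x} {y} (wrap x≡y) = wrap (subst (m ∣_) (ℤP.∣i-j∣≡∣j-i∣ x y) x≡y)

  ≈-mod-trans : ∀ {x y z} → x ≈ y [mod m ] → y ≈ z [mod m ] → x ≈ z [mod m ]
  ≈-mod-trans {x} {y} {z} x≈y y≈z =
    fromSigned (subst (+ m ℤS.∣_) (telescope x y z) (ℤS.∣m∣n⇒∣m+n (toSigned x≈y) (toSigned y≈z)))
    where
    telescope : ∀ x y z → (x - y) + (y - z) ≡ x - z
    telescope = solve-∀

  ≈-mod-+ : ∀ {x y u v} → x ≈ y [mod m ] → u ≈ v [mod m ] → x + u ≈ y + v [mod m ]
  ≈-mod-+ {x} {y} {u} {v} x≈y u≈v =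
    fromSigned (subst (+ m ℤS.∣_) (regroup x y u v) (ℤS.∣m∣n⇒∣m+n (toSigned x≈y) (toSigned u≈v)))
    where
    regroup : ∀ x y u v → (x - y) + (u - v) ≡ (x + u) - (y + v)
    regroup = solve-∀

  ≈-mod-* : ∀ {x y u v} → x ≈ y [mod m ] → u ≈ v [mod m ] → x * u ≈ y * v [mod m ]
  ≈-mod-* {x} {y} {u} {v} x≈y u≈v =
    fromSigned (subst (+ m ℤS.∣_) (regroup x y u v)
      (ℤS.∣m∣n⇒∣m+n (ℤS.∣m⇒∣m*n u (toSigned x≈y)) (ℤS.∣n⇒∣m*n y (toSigned u≈v))))
    where
    regroup : ∀ x y u v → (x - y) * u + y * (u - v) ≡ x * u - y * v
    regroup = solve-∀

  ≈-mod⇒∣ : ∀ {x y} → x ≈ y [mod m ] → + m ℤD.∣ y → + m ℤD.∣ x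
  ≈-mod⇒∣ {x} {y} x≈y m∣y =
    ℤS.∣⇒∣ᵤ (subst (+ m ℤS.∣_) (cancel x y) (ℤS.∣m∣n⇒∣m+n (toSigned x≈y) (ℤS.∣ᵤ⇒∣ {+ m} {y} m∣y)))
    where
    cancel : ∀ x y → (x - y) + y ≡ x
    cancel = solve-∀

≈-mod-∣ : ∀ {m n x y} → m ∣ n → x ≈ y [mod n ] → x ≈ y [mod m ]
≈-mod-∣ m∣n (wrap x≡y) = wrap (∣-trans m∣n x≡y)

≈-mod-setoid : ℕ → Setoid 0ℓ 0ℓ
≈-mod-setoid m = record
  { Carrier       = ℤ
  ; _≈_           = _≈_[mod m ]
  ; isEquivalence = record { refl = ≈-mod-reflexive refl ; sym = ≈-mod-sym ; trans = ≈-mod-trans }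
  }

module ≈-mod-Reasoning (m : ℕ) = Relation.Binary.Reasoning.Setoid (≈-mod-setoid m)

≈-mod-+-shift : ∀ {m x r n} d t → r ℕ.+ d ℕ.* t ≡ n →
                + d * + x ≈ + r [mod m ] → + d * + (x ℕ.+ t) ≈ + n [mod m ]
≈-mod-+-shift {m} {x} {r} d t refl dx≈r = begin
  + d * + (x ℕ.+ t)      ≡⟨ cong (+ d *_) (ℤP.pos-+ x t) ⟩
  + d * (+ x + + t)      ≡⟨ ℤP.*-distribˡ-+ (+ d) (+ x) (+ t) ⟩
  + d * + x + + d * + t  ≈⟨ ≈-mod-+ dx≈r (≈-mod-reflexive refl) ⟩
  + r + + d * + t        ≡⟨ cong (λ n → + r + n) (ℤP.pos-* d t) ⟨
  + r + + (d ℕ.* t)      ≡⟨ ℤP.pos-+ r (d ℕ.* t) ⟨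
  + (r ℕ.+ d ℕ.* t)      ∎
  where open ≈-mod-Reasoning m

≈-mod-cross-multiply : ∀ {m G Π R} c c′ → G * Π ≡ R → c * Π ≈ c′ [mod m ] → c′ * G ≈ c * R [mod m ]
≈-mod-cross-multiply {m} {G} {Π} {R} c c′ GΠ≡R cΠ≈c′ = begin
  c′ * G        ≈⟨ ≈-mod-* (≈-mod-sym cΠ≈c′) (≈-mod-reflexive refl) ⟩
  c * Π * G     ≡⟨ regroup c Π G ⟩
  c * (G * Π)   ≡⟨ cong (c *_) GΠ≡R ⟩
  c * R         ∎
  where
  open ≈-mod-Reasoning m
  regroup : ∀ c Π G → c * Π * G ≡ c * (G * Π)
  regroup = solve-∀

prime-∣-of-≈-mod : ∀ {p d n c M} → Prime p → p ∤ d → p ∣ M → + d * + n ≈ + c [mod M ] → p ∣ c → p ∣ n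
prime-∣-of-≈-mod {p} {d} {n} p-prime p∤d p∣M dn≈c p∣c =
  [ (λ p∣d → contradiction p∣d p∤d) , (λ p∣n → p∣n) ]′ (euclidsLemma d n p-prime p∣dn)
  where
  p∣dn : p ∣ d ℕ.* n
  p∣dn = subst (p ∣_) (ℤP.abs-* (+ d) (+ n)) (≈-mod⇒∣ (≈-mod-∣ p∣M dn≈c) p∣c)

record ExcessCases (p d N j M : ℕ) (Π : ℤ) : Set where
  constructor excessCases
  field
    small  : j ≤ N → Π ≡ + 1
    middle : N < j → j ≤ p ∸ N ∸ 1 → + d * Π ≈ + p [mod M ]
    large  : p ∸ N ≤ j → j ≤ p ∸ 1 → + d * + d * Π ≈ + (d ∸ 1) * + p * + p [mod M ]

GammaCases : (p d N j M : ℕ) → ℤ → ℤ → Set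
GammaCases p d N j M G R =
  (j ≤ N → G ≡ R [mod M ])
  × (N < j → j ≤ p ∸ N ∸ 1 → + p * G ≡ + d * R [mod M ])
  × (p ∸ N ≤ j → j ≤ p ∸ 1 → + (d ∸ 1) * + p * + p * G ≡ + d * + d * R [mod M ])

excessCases⇒gammaCases : ∀ {p d N j M Π R} G → G * Π ≡ R →
                         ExcessCases p d N j M Π → GammaCases p d N j M G R
excessCases⇒gammaCases {p} {d} G GΠ≡R (excessCases small middle large) =
  (λ j≤N → unwrap (≈-mod-reflexive (G≡R j≤N)))
  , (λ N<j j≤T → unwrap (≈-mod-cross-multiply (+ d) (+ p) GΠ≡R (middle N<j j≤T)))
  , (λ p-N≤j j<p → unwrap (≈-mod-cross-multiply (+ d * + d) (+ (d ∸ 1) * + p * + p) GΠ≡R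
                                                (large p-N≤j j<p)))
  where
  G≡R = λ j≤N → trans (sym (ℤP.*-identityʳ G)) (trans (cong (G *_) (sym (small j≤N))) GΠ≡R)

multiplesProd-excessCases : ∀ {p d q x y M} → Prime p → p ∤ d → p ∣ M → q < p → q ≤ p ∸ q ∸ 1 →
                            + d * + (x ℕ.+ q) ≈ + p [mod M ] →
                            + d * + (y ℕ.+ (p ∸ q ∸ 1)) ≈ + ((d ∸ 1) ℕ.* p) [mod M ] →
                            ∀ j → j ≤ p ∸ 1 →
                            ExcessCases p d q j M (multiplesProd p x j * multiplesProd p y j)
multiplesProd-excessCases {p} {d} {q} {x} {y} {M} p-prime p∤d p∣M q<p q≤T d[x+q]≈p d[y+T]≈[d-1]p j j≤p-1 =
  excessCases small middle large
  where
  T = p ∸ q ∸ 1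
  Πx = multiplesProd p x j
  Πy = multiplesProd p y j
  j≤p : j ≤ p
  j≤p = ℕP.≤-trans j≤p-1 (ℕP.m∸n≤m p 1)
  T<p-q : T < p ∸ q
  T<p-q = ℕP.∸-monoʳ-< (s≤s z≤n) (ℕP.m<n⇒0<n∸m q<p)
  T<p : T < p
  T<p = ℕP.<-≤-trans T<p-q (ℕP.m∸n≤m p q)
  p∣x+q : p ∣ x ℕ.+ q
  p∣x+q = prime-∣-of-≈-mod p-prime p∤d p∣M d[x+q]≈p ∣-refl
  p∣y+T : p ∣ y ℕ.+ T
  p∣y+T = prime-∣-of-≈-mod p-prime p∤d p∣M d[y+T]≈[d-1]p (n∣m*n (d ∸ 1))
  small : j ≤ q → Πx * Πy ≡ + 1
  small j≤q = cong₂ _*_ (multiplesProd-before j q<p p∣x+q j≤q)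
                        (multiplesProd-before j T<p p∣y+T (ℕP.≤-trans j≤q q≤T))
  middle : q < j → j ≤ T → + d * (Πx * Πy) ≈ + p [mod M ]
  middle q<j j≤T = begin
    + d * (Πx * Πy)
      ≡⟨ cong₂ (λ u v → + d * (u * v)) (multiplesProd-after j q<j j≤p p∣x+q)
                                        (multiplesProd-before j T<p p∣y+T j≤T) ⟩
    + d * (+ (x ℕ.+ q) * + 1)
      ≡⟨ cong (+ d *_) (ℤP.*-identityʳ _) ⟩
    + d * + (x ℕ.+ q)
      ≈⟨ d[x+q]≈p ⟩
    + p ∎
    where open ≈-mod-Reasoning M
  large : p ∸ q ≤ j → j ≤ p ∸ 1 → + d * + d * (Πx * Πy) ≈ + (d ∸ 1) * + p * + p [mod M ]
  large p-q≤j _ = begin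
    + d * + d * (Πx * Πy)
      ≡⟨ cong₂ (λ u v → + d * + d * (u * v))
           (multiplesProd-after j (ℕP.<-≤-trans (ℕP.≤-<-trans q≤T T<p-q) p-q≤j) j≤p p∣x+q)
           (multiplesProd-after j (ℕP.<-≤-trans T<p-q p-q≤j) j≤p p∣y+T) ⟩
    + d * + d * (+ (x ℕ.+ q) * + (y ℕ.+ T))
      ≡⟨ interchange (+ d) (+ (x ℕ.+ q)) (+ (y ℕ.+ T)) ⟩
    + d * + (x ℕ.+ q) * (+ d * + (y ℕ.+ T))
      ≈⟨ ≈-mod-* d[x+q]≈p d[y+T]≈[d-1]p ⟩
    + p * + ((d ∸ 1) ℕ.* p)
      ≡⟨ cong (+ p *_) (ℤP.pos-* (d ∸ 1) p) ⟩
    + p * (+ (d ∸ 1) * + p)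
      ≡⟨ rotate (+ p) (+ (d ∸ 1)) ⟩
    + (d ∸ 1) * + p * + p ∎
    where
    open ≈-mod-Reasoning M
    interchange : ∀ d u v → d * d * (u * v) ≡ d * u * (d * v)
    interchange = solve-∀
    rotate : ∀ p e → p * (e * p) ≡ e * p * p
    rotate = solve-∀

excessCases-of-residue : ∀ {p d r s} .{{_ : NonZero d}} k x y → Prime p → 1 < d → d < p →
                         0 < r → r ℕ.+ s ≡ d → p % d ≡ r →
                         + d * + x ≈ + r [mod p ^ suc k ] → + d * + y ≈ + s [mod p ^ suc k ] →
                         ∀ j → j ≤ p ∸ 1 →
                         ExcessCases p d ((p ∸ 1) / d) j (p ^ suc k) (multiplesProd p x j * multiplesProd p y j)
excessCases-of-residue {p} {d} {r} {s} k x y p-prime 1<d d<p 0<r r+s≡d p%d≡r dx≈r dy≈s j j≤p-1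
  with division-facts (p / d) 0<r 1<d r+s≡d (trans (m≡m%n+[m/n]*n p d) (cong (ℕ._+ p / d ℕ.* d) p%d≡r))
... | N≡q , q<p , q≤T , r+dq≡p , s+dT≡[d-1]p =
  subst (λ N → ExcessCases p d N j (p ^ suc k) (multiplesProd p x j * multiplesProd p y j)) (sym N≡q)
    (multiplesProd-excessCases p-prime (>⇒∤ d<p) (m∣m*n (p ^ k)) q<p q≤T
      (≈-mod-+-shift d (p / d) r+dq≡p dx≈r) (≈-mod-+-shift d (p ∸ p / d ∸ 1) s+dT≡[d-1]p dy≈s)
      j j≤p-1)

excessCases-of-inverses : ∀ {p d} .{{_ : NonZero d}} k a b → Prime p → 1 < d → d < p → totient d ≤ 2 →
                          + d * + a ≈ + 1 [mod p ^ suc k ] → + d * + b ≈ + (d ∸ 1) [mod p ^ suc k ] →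
                          ∀ j → j ≤ p ∸ 1 →
                          ExcessCases p d ((p ∸ 1) / d) j (p ^ suc k) (multiplesProd p a j * multiplesProd p b j)
excessCases-of-inverses {p} {d} k a b p-prime 1<d d<p totient≤2 da≈1 db≈d-1 j j≤p-1
  with prime-%-≡1⊎≡pred p-prime 1<d d<p totient≤2
... | inj₁ p%d≡1 =
  excessCases-of-residue k a b p-prime 1<d d<p (s≤s z≤n) (ℕP.m+[n∸m]≡n 1≤d) p%d≡1 da≈1 db≈d-1 j j≤p-1
  where 1≤d = ℕP.<⇒≤ 1<d
... | inj₂ p%d≡d-1 =
  subst (ExcessCases p d ((p ∸ 1) / d) j (p ^ suc k)) (ℤP.*-comm (multiplesProd p b j) (multiplesProd p a j))
    (excessCases-of-residue k b a p-prime 1<d d<p (ℕP.m<n⇒0<n∸m 1<d) (ℕP.m∸n+n≡m 1≤d) p%d≡d-1 db≈d-1 da≈1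
                            j j≤p-1)
  where 1≤d = ℕP.<⇒≤ 1<d

lemma2p24 : (p d : ℕ) .{{_ : NonZero d}} → Prime p → 1 < d → d < p → totient d ≤ 2 →
            (j : ℕ) → j ≤ p ∸ 1 →
            -- p-adic integers are compared modulo p^k for every k;
            -- a, b are natural representatives of 1/d and (d-1)/d modulo p^k
            (k a b : ℕ) →
            (+ d) * (+ a) ≡ + 1 [mod p ^ k ] →
            (+ d) * (+ b) ≡ + (d ∸ 1) [mod p ^ k ] →
            ((j ≤ (p ∸ 1) / d) →
               Γₚℕ p (a Data.Nat.+ j) * Γₚℕ p (b Data.Nat.+ j)
               ≡ Γₚℕ p a * Γₚℕ p b * poch (+ a) j * poch (+ b) j [mod p ^ k ])
            × (((p ∸ 1) / d < j) → j ≤ p ∸ ((p ∸ 1) / d) ∸ 1 →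
               (+ p) * (Γₚℕ p (a Data.Nat.+ j) * Γₚℕ p (b Data.Nat.+ j))
               ≡ (+ d) * (Γₚℕ p a * Γₚℕ p b * poch (+ a) j * poch (+ b) j) [mod p ^ k ])
            × (p ∸ ((p ∸ 1) / d) ≤ j → j ≤ p ∸ 1 →
               (+ (d ∸ 1)) * (+ p) * (+ p) * (Γₚℕ p (a Data.Nat.+ j) * Γₚℕ p (b Data.Nat.+ j))
               ≡ (+ d) * (+ d) * (Γₚℕ p a * Γₚℕ p b * poch (+ a) j * poch (+ b) j) [mod p ^ k ])
lemma2p24 p d p-prime 1<d d<p totient≤2 j j≤p-1 zero a b _ _ =
  (λ _ → 1∣ _) , (λ _ _ → 1∣ _) , (λ _ _ → 1∣ _)
lemma2p24 p d p-prime 1<d d<p totient≤2 j j≤p-1 (suc k) a b da≡1 db≡d-1 =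
  excessCases⇒gammaCases (Γₚℕ p (a ℕ.+ j) * Γₚℕ p (b ℕ.+ j)) (Γₚℕ-pair-shift p a b j)
    (excessCases-of-inverses k a b p-prime 1<d d<p totient≤2 (wrap da≡1) (wrap db≡d-1) j j≤p-1)
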